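{- For any integers $r>s\ge1$ with $r\ge3$, the homomorphism $\tilde P_{r,s}:\tilde M_{r,s,\infty}\to H$ is surjective.
   Context: $T_\infty$ is the infinite binary rooted tree whose nodes are finite words in $\{a,b\}$ ($w$ joined to $wa,wb$), with automorphism group $\mathrm{Aut}(T_\infty)$. $\mathrm{Par}(\sigma,x)\in\mathbb{Z}/2\mathbb{Z}$ is $0$ if $\sigma(xa)=\sigma(x)a$ and $1$ if $\sigma(xa)=\sigma(x)b$. $P^a_{r,s}(\sigma,x)=\sum_{w\in\{a,b\}^{r-1}}\mathrm{Par}(\sigma,xaw)+\sum_{w'\in\{a,b\}^{s-1}}\mathrm{Par}(\sigma,xbw')$, $P^b_{r,s}(\sigma,x)=\sum_{w\in\{a,b\}^{r-1}}\mathrm{Par}(\sigma,xbw)+\sum_{w'\in\{a,b\}^{s-1}}\mathrm{Par}(\sigma,xaw')$ (mod 2); $M_{r,s,\infty}$ = set of $\sigma$ with all these values over all nodes equal (common value $P_{r,s}(\sigma)$); $B_{r,s,\infty}=\{P_{r,s}=0\}$. $R_{3,2}(\sigma,x)=\sum_{w\in\{a,b\}^2}[\mathrm{Par}(\sigma,xw)+\mathrm{Par}(\sigma,xwb)+\sum_{t\in\{a,b\}}\mathrm{Par}(\sigma,xwat)]+[\mathrm{Par}(\sigma,xaa)+\mathrm{Par}(\sigma,xab)][\mathrm{Par}(\sigma,xba)+\mathrm{Par}(\sigma,xbb)]$; $R_{r,1}(\sigma,x)=\mathrm{Par}(\sigma,xa)\mathrm{Par}(\sigma,xb)+\sum_{w\in\{a,b\}^{r-2}}(\mathrm{Par}(\sigma,xabw)+\mathrm{Par}(\sigma,xbbw))$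 (mod 2). Definitions by case: if $r\ge4,s\ge2$: $\tilde M_{r,s,\infty}=M_{r,s,\infty}$, $H=\mathbb{Z}/2\mathbb{Z}$, $\tilde P_{r,s}=P_{r,s}$. If $(r,s)=(3,2)$: $\tilde M_{3,2,\infty}=\{\sigma\in M_{3,2,\infty}:R_{3,2}(\sigma,x)\text{ independent of }x\}$, with common value $R_{3,2}(\sigma)$, $H=\mathbb{Z}/2\mathbb{Z}\times\mathbb{Z}/2\mathbb{Z}$, $\tilde P_{3,2}(\sigma)=(P_{3,2}(\sigma),R_{3,2}(\sigma))$. If $s=1$, $r\ge3$: $\tilde M_{r,1,\infty}=\{\sigma\in B_{r,1,\infty}:R_{r,1}(\sigma,x)\text{ independent of }x\}$ with common value $R_{r,1}(\sigma)$, $H=\mathbb{Z}/2\mathbb{Z}$, $\tilde P_{r,1}=R_{r,1}$. (These are groups and $\tilde P_{r,s}$ is a homomorphism.) -}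

module Defs where

open import Data.Bool using (Bool; true; false; _xor_; _∧_; if_then_else_)
open import Data.Nat using (ℕ; zero; suc; _∸_)
open import Data.List using (List; []; _∷_; _++_; [_]; map; concatMap; foldr)
open import Data.Product using (_×_; _,_; ∃-syntax)
open import Data.Sum using (_⊎_)
open import Relation.Nullary using (yes; no)
open import Relation.Binary.PropositionalEquality using (_≡_)
import Data.List.Properties as LP

data Letter : Set where
  a b : Letter

_≟L_ : (x y : Letter) → Relation.Nullary.Dec (x ≡ y)
a ≟L a = yes _≡_.refl
a ≟L b = no (λ ())
b ≟L a = no (λ ())
b ≟L b = yes _≡_.refl

-- Nodes of T∞: finite words, read from the root; the children of x are x ++ [ a ], x ++ [ b ].
Word : Set
Word = List Letter

_≟W_ : (x y : Word) → Relation.Nullary.Dec (x ≡ y)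
_≟W_ = LP.≡-dec _≟L_

Adj : Word → Word → Set
Adj x y = (∃[ c ] y ≡ x ++ [ c ]) ⊎ (∃[ c ] x ≡ y ++ [ c ])

record IsAut (σ : Word → Word) : Set where
  field
    inv      : Word → Word
    inv-left : ∀ x → inv (σ x) ≡ x
    inv-right : ∀ x → σ (inv x) ≡ x
    root     : σ [] ≡ []
    adj⇒     : ∀ x y → Adj x y → Adj (σ x) (σ y)
    adj⇐     : ∀ x y → Adj (σ x) (σ y) → Adj x y

-- Z/2Z is modelled by Bool with xor as addition and ∧ as multiplication.
-- Par(σ,x) = 0 (false) if σ(xa) = σ(x)a, and 1 (true) otherwise (i.e. σ(xa) = σ(x)b).
Par : (Word → Word) → Word → Bool
Par σ x with σ (x ++ [ a ]) ≟W (σ x ++ [ a ])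
... | yes _ = false
... | no _  = true

words : ℕ → List Word
words zero    = [] ∷ []
words (suc n) = concatMap (λ w → (a ∷ w) ∷ (b ∷ w) ∷ []) (words n)

Σw : ℕ → (Word → Bool) → Bool
Σw n f = foldr _xor_ false (map f (words n))

Pa : ℕ → ℕ → (Word → Word) → Word → Bool
Pa r s σ x = Σw (r ∸ 1) (λ w → Par σ (x ++ a ∷ w)) xor Σw (s ∸ 1) (λ w → Par σ (x ++ b ∷ w))

Pb : ℕ → ℕ → (Word → Word) → Word → Bool
Pb r s σ x = Σw (r ∸ 1) (λ w → Par σ (x ++ b ∷ w)) xor Σw (s ∸ 1) (λ w → Par σ (x ++ a ∷ w))

InM : ℕ → ℕ → (Word → Word) → Set
InM r s σ = ∀ x → (Pa r s σ x ≡ Pa r s σ []) × (Pb r s σ x ≡ Pa r s σ [])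

P : ℕ → ℕ → (Word → Word) → Bool
P r s σ = Pa r s σ []

InB : ℕ → ℕ → (Word → Word) → Set
InB r s σ = InM r s σ × (P r s σ ≡ false)

R32 : (Word → Word) → Word → Bool
R32 σ x =
  Σw 2 (λ w → Par σ (x ++ w) xor Par σ (x ++ w ++ [ b ])
              xor (Par σ (x ++ w ++ a ∷ a ∷ []) xor Par σ (x ++ w ++ a ∷ b ∷ [])))
  xor ((Par σ (x ++ a ∷ a ∷ []) xor Par σ (x ++ a ∷ b ∷ []))
       ∧ (Par σ (x ++ b ∷ a ∷ []) xor Par σ (x ++ b ∷ b ∷ [])))

Rr1 : ℕ → (Word → Word) → Word → Bool
Rr1 r σ x = (Par σ (x ++ [ a ]) ∧ Par σ (x ++ [ b ]))
  xor Σw (r ∸ 2) (λ w → Par σ (x ++ a ∷ b ∷ w) xor Par σ (x ++ b ∷ b ∷ w))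

H : ℕ → ℕ → Set
H r zero = Bool
H r (suc zero) = Bool
H zero (suc (suc s)) = Bool
H (suc zero) (suc (suc s)) = Bool
H (suc (suc zero)) (suc (suc s)) = Bool
H (suc (suc (suc zero))) (suc (suc zero)) = Bool × Bool
H (suc (suc (suc zero))) (suc (suc (suc s))) = Bool
H (suc (suc (suc (suc r)))) (suc (suc s)) = Bool

InMt : ℕ → ℕ → (Word → Word) → Set
InMt r zero σ = InM r zero σ
InMt r (suc zero) σ = InB r 1 σ × (∀ x → Rr1 r σ x ≡ Rr1 r σ [])
InMt zero (suc (suc s)) σ = InM zero (suc (suc s)) σ
InMt (suc zero) (suc (suc s)) σ = InM 1 (suc (suc s)) σ
InMt (suc (suc zero)) (suc (suc s)) σ = InM 2 (suc (suc s)) σ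
InMt (suc (suc (suc zero))) (suc (suc zero)) σ = InM 3 2 σ × (∀ x → R32 σ x ≡ R32 σ [])
InMt (suc (suc (suc zero))) (suc (suc (suc s))) σ = InM 3 (suc (suc (suc s))) σ
InMt (suc (suc (suc (suc r)))) (suc (suc s)) σ = InM (suc (suc (suc (suc r)))) (suc (suc s)) σ

Pt : (r s : ℕ) → (Word → Word) → H r s
Pt r zero σ = P r zero σ
Pt r (suc zero) σ = Rr1 r σ []
Pt zero (suc (suc s)) σ = P zero (suc (suc s)) σ
Pt (suc zero) (suc (suc s)) σ = P 1 (suc (suc s)) σ
Pt (suc (suc zero)) (suc (suc s)) σ = P 2 (suc (suc s)) σ
Pt (suc (suc (suc zero))) (suc (suc zero)) σ = P 3 2 σ , R32 σ []
Pt (suc (suc (suc zero))) (suc (suc (suc s))) σ = P 3 (suc (suc (suc s))) σ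
Pt (suc (suc (suc (suc r)))) (suc (suc s)) σ = P (suc (suc (suc (suc r)))) (suc (suc s)) σ

-- All witnesses are finite-state automorphisms: the portrait of σ at a node x (whether σ
-- swaps the two children of x) is an output bit of a finite automaton that has read x.
-- Then Par σ (x ++ y) depends only on the state reached at x and on y, so each of
-- P^a, P^b, R_{3,2}, R_{r,1} at x is a function of that state, and membership in M̃
-- together with the value of P̃ is a finite check over the states. The identity gives
-- the neutral element; P = 1 for r > s is realised by the automaton counting trailing
-- b's (its sums over the words of length k are 1 exactly for k = s - 1 among k ≥ s - 1),
-- and the remaining generators are small automata with at most six states.
module Submission where

open import Defs
open import Algebra.Bundles using (CommutativeRing)
open import Data.Bool using (Bool; true; false; _xor_; _∧_)
open import Data.Bool.Properties using (xor-assoc; xor-identityʳ; xor-∧-commutativeRing)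
open import Data.Empty using (⊥-elim)
open import Data.List using (List; []; _∷_; _++_; [_]; map; concatMap; foldr)
open import Data.List.Properties using (++-assoc; ++-identityʳ; ++-cancelˡ; ∷-injectiveˡ)
open import Data.Nat using (ℕ; _≤_; _<_; zero; suc; _+_; _∸_; s≤s; _≤?_)
open import Data.Nat.Properties using (+-suc; +-identityʳ; ≤-refl; <⇒≤; <⇒≱; m≤n+m; m<1+n⇒m<n∨m≡n)
open import Data.Product using (_×_; ∃-syntax; _,_; proj₁; proj₂)
open import Data.Sum using (inj₁; inj₂)
open import Data.Unit using (⊤; tt)
open import Function using (_∘_)
open import Relation.Binary.PropositionalEquality using (_≡_; _≢_; refl; sym; trans; cong; cong₂)
open import Relation.Nullary using (yes; no; does)
open import Relation.Nullary.Decidable using (dec-true; dec-false)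
open import Algebra.Properties.CommutativeSemigroup
  (CommutativeRing.+-commutativeSemigroup xor-∧-commutativeRing) using (interchange)

toggle : Bool → Letter → Letter
toggle false c = c
toggle true  a = b
toggle true  b = a

toggle-involutive : ∀ t c → toggle t (toggle t c) ≡ c
toggle-involutive false c = refl
toggle-involutive true  a = refl
toggle-involutive true  b = refl

module Portrait (p : Word → Bool) where

  -- act u w is σ (u ++ w) with the prefix σ u removed; act⁻¹ u inverts it.
  act : Word → Word → Word
  act u []      = []
  act u (c ∷ w) = toggle (p u) c ∷ act (u ++ [ c ]) w

  act⁻¹ : Word → Word → Word
  act⁻¹ u []      = []
  act⁻¹ u (c ∷ w) = toggle (p u) c ∷ act⁻¹ (u ++ [ toggle (p u) c ]) w

  act-++ : ∀ u x y → act u (x ++ y) ≡ act u x ++ act (u ++ x) y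
  act-++ u []      y = cong (λ v → act v y) (sym (++-identityʳ u))
  act-++ u (c ∷ x) y = cong (toggle (p u) c ∷_)
    (trans (act-++ (u ++ [ c ]) x y)
           (cong (λ v → act (u ++ [ c ]) x ++ act v y) (++-assoc u [ c ] x)))

  act⁻¹-++ : ∀ u x y → act⁻¹ u (x ++ y) ≡ act⁻¹ u x ++ act⁻¹ (u ++ act⁻¹ u x) y
  act⁻¹-++ u []      y = cong (λ v → act⁻¹ v y) (sym (++-identityʳ u))
  act⁻¹-++ u (c ∷ x) y = cong (c′ ∷_)
    (trans (act⁻¹-++ (u ++ [ c′ ]) x y)
           (cong (λ v → act⁻¹ (u ++ [ c′ ]) x ++ act⁻¹ v y)
                 (++-assoc u [ c′ ] (act⁻¹ (u ++ [ c′ ]) x))))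
    where c′ = toggle (p u) c

  act⁻¹-act : ∀ u w → act⁻¹ u (act u w) ≡ w
  act⁻¹-act u []      = refl
  act⁻¹-act u (c ∷ w) rewrite toggle-involutive (p u) c = cong (c ∷_) (act⁻¹-act (u ++ [ c ]) w)

  act-act⁻¹ : ∀ u w → act u (act⁻¹ u w) ≡ w
  act-act⁻¹ u []      = refl
  act-act⁻¹ u (c ∷ w) rewrite toggle-involutive (p u) c =
    cong (c ∷_) (act-act⁻¹ (u ++ [ toggle (p u) c ]) w)

  σ σ⁻¹ : Word → Word
  σ   = act []
  σ⁻¹ = act⁻¹ []

  σ-snoc : ∀ x c → σ (x ++ [ c ]) ≡ σ x ++ [ toggle (p x) c ]
  σ-snoc x c = act-++ [] x [ c ]

  σ⁻¹-snoc-σ : ∀ x c → σ⁻¹ (σ x ++ [ c ]) ≡ x ++ [ toggle (p x) c ]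
  σ⁻¹-snoc-σ x c = trans (act⁻¹-++ [] (σ x) [ c ])
    (cong (λ y → y ++ [ toggle (p y) c ]) (act⁻¹-act [] x))

  σ-snoc⁻¹ : ∀ {x y c} → σ y ≡ σ x ++ [ c ] → y ≡ x ++ [ toggle (p x) c ]
  σ-snoc⁻¹ {x} {y} {c} σy≡σx·c =
    trans (sym (act⁻¹-act [] y)) (trans (cong σ⁻¹ σy≡σx·c) (σ⁻¹-snoc-σ x c))

  adj⇒ : ∀ x y → Adj x y → Adj (σ x) (σ y)
  adj⇒ x ._ (inj₁ (c , refl)) = inj₁ (_ , σ-snoc x c)
  adj⇒ ._ y (inj₂ (c , refl)) = inj₂ (_ , σ-snoc y c)

  adj⇐ : ∀ x y → Adj (σ x) (σ y) → Adj x y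
  adj⇐ x y (inj₁ (c , e)) = inj₁ (_ , σ-snoc⁻¹ e)
  adj⇐ x y (inj₂ (c , e)) = inj₂ (_ , σ-snoc⁻¹ e)

  isAut : IsAut σ
  isAut = record
    { inv = σ⁻¹ ; inv-left = act⁻¹-act [] ; inv-right = act-act⁻¹ []
    ; root = refl ; adj⇒ = adj⇒ ; adj⇐ = adj⇐ }

  Par-σ : ∀ x → Par σ x ≡ p x
  Par-σ x with σ (x ++ [ a ]) ≟W (σ x ++ [ a ]) | σ-snoc x a
  ... | yes e | σxa with p x
  ...   | false = refl
  ...   | true  = ⊥-elim (b≢a (∷-injectiveˡ (++-cancelˡ (σ x) _ _ (trans (sym σxa) e))))
    where b≢a : b ≢ a
          b≢a ()
  Par-σ x | no ne | σxa with p x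
  ...   | false = ⊥-elim (ne σxa)
  ...   | true  = refl

xorSum : List Word → (Word → Bool) → Bool
xorSum ws f = foldr _xor_ false (map f ws)

xorSum-cong : ∀ ws {f g : Word → Bool} → (∀ w → f w ≡ g w) → xorSum ws f ≡ xorSum ws g
xorSum-cong []       f≗g = refl
xorSum-cong (w ∷ ws) f≗g = cong₂ _xor_ (f≗g w) (xorSum-cong ws f≗g)

xorSum-xor : ∀ ws (f g : Word → Bool) →
  xorSum ws (λ w → f w xor g w) ≡ xorSum ws f xor xorSum ws g
xorSum-xor []       f g = refl
xorSum-xor (w ∷ ws) f g =
  trans (cong ((f w xor g w) xor_) (xorSum-xor ws f g)) (interchange (f w) (g w) _ _)

xorSum-children : ∀ ws (f : Word → Bool) →
  xorSum (concatMap (λ w → (a ∷ w) ∷ (b ∷ w) ∷ []) ws) f ≡ xorSum ws (λ w → f (a ∷ w) xor f (b ∷ w))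
xorSum-children []       f = refl
xorSum-children (w ∷ ws) f = trans (sym (xor-assoc (f (a ∷ w)) (f (b ∷ w)) _))
  (cong ((f (a ∷ w) xor f (b ∷ w)) xor_) (xorSum-children ws f))

Σw-cong : ∀ n {f g : Word → Bool} → (∀ w → f w ≡ g w) → Σw n f ≡ Σw n g
Σw-cong n = xorSum-cong (words n)

Σw-xor : ∀ n (f g : Word → Bool) → Σw n (λ w → f w xor g w) ≡ Σw n f xor Σw n g
Σw-xor n = xorSum-xor (words n)

Σw-suc : ∀ n (f : Word → Bool) → Σw (suc n) f ≡ Σw n (λ w → f (a ∷ w) xor f (b ∷ w))
Σw-suc n = xorSum-children (words n)

module Transducer {S : Set} (δ : S → Letter → S) (q₀ : S) (out : S → Bool) where

  run : S → Word → S
  run q []      = q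
  run q (c ∷ w) = run (δ q c) w

  run-++ : ∀ q x y → run q (x ++ y) ≡ run (run q x) y
  run-++ q []      y = refl
  run-++ q (c ∷ x) y = run-++ (δ q c) x y

  state : Word → S
  state = run q₀

  open Portrait (out ∘ state) public

  Par-σ-++ : ∀ x y → Par σ (x ++ y) ≡ out (run (state x) y)
  Par-σ-++ x y = trans (Par-σ (x ++ y)) (cong out (run-++ q₀ x y))

  Σout : ℕ → S → Bool
  Σout k q = Σw k (out ∘ run q)

  Σout-suc : ∀ k q → Σout (suc k) q ≡ Σout k (δ q a) xor Σout k (δ q b)
  Σout-suc k q = trans (Σw-suc k _) (Σw-xor k _ _)

  Σw-Par-σ : ∀ k x c → Σw k (λ w → Par σ (x ++ c ∷ w)) ≡ Σout k (δ (state x) c)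
  Σw-Par-σ k x c = Σw-cong k (λ w → Par-σ-++ x (c ∷ w))

  Paˢ Pbˢ : ℕ → ℕ → S → Bool
  Paˢ r s q = Σout (r ∸ 1) (δ q a) xor Σout (s ∸ 1) (δ q b)
  Pbˢ r s q = Σout (r ∸ 1) (δ q b) xor Σout (s ∸ 1) (δ q a)

  R32ˢ : S → Bool
  R32ˢ q =
    Σw 2 (λ w → out (run q w) xor out (run q (w ++ [ b ]))
                xor (out (run q (w ++ a ∷ a ∷ [])) xor out (run q (w ++ a ∷ b ∷ []))))
    xor ((out (run q (a ∷ a ∷ [])) xor out (run q (a ∷ b ∷ [])))
         ∧ (out (run q (b ∷ a ∷ [])) xor out (run q (b ∷ b ∷ []))))

  Rr1ˢ : ℕ → S → Bool
  Rr1ˢ r q = (out (run q [ a ]) ∧ out (run q [ b ]))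
    xor (Σout (r ∸ 2) (run q (a ∷ b ∷ [])) xor Σout (r ∸ 2) (run q (b ∷ b ∷ [])))

  Pa-σ : ∀ r s x → Pa r s σ x ≡ Paˢ r s (state x)
  Pa-σ r s x = cong₂ _xor_ (Σw-Par-σ (r ∸ 1) x a) (Σw-Par-σ (s ∸ 1) x b)

  Pb-σ : ∀ r s x → Pb r s σ x ≡ Pbˢ r s (state x)
  Pb-σ r s x = cong₂ _xor_ (Σw-Par-σ (r ∸ 1) x b) (Σw-Par-σ (s ∸ 1) x a)

  R32-σ : ∀ x → R32 σ x ≡ R32ˢ (state x)
  R32-σ x = cong₂ _xor_
    (Σw-cong 2 (λ w → cong₂ _xor_ (Par-σ-++ x w) (cong₂ _xor_ (Par-σ-++ x (w ++ [ b ]))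
                        (cong₂ _xor_ (Par-σ-++ x (w ++ a ∷ a ∷ [])) (Par-σ-++ x (w ++ a ∷ b ∷ []))))))
    (cong₂ _∧_ (cong₂ _xor_ (Par-σ-++ x (a ∷ a ∷ [])) (Par-σ-++ x (a ∷ b ∷ [])))
               (cong₂ _xor_ (Par-σ-++ x (b ∷ a ∷ [])) (Par-σ-++ x (b ∷ b ∷ []))))

  Rr1-σ : ∀ r x → Rr1 r σ x ≡ Rr1ˢ r (state x)
  Rr1-σ r x = cong₂ _xor_ (cong₂ _∧_ (Par-σ-++ x [ a ]) (Par-σ-++ x [ b ]))
    (trans (Σw-cong (r ∸ 2) (λ w → cong₂ _xor_ (Par-σ-++ x (a ∷ b ∷ w)) (Par-σ-++ x (b ∷ b ∷ w))))
           (Σw-xor (r ∸ 2) _ _))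

  constant-via-state : ∀ {T : Set} (f : Word → T) (F : S → T) {v : T} →
    (∀ x → f x ≡ F (state x)) → (∀ q → F q ≡ v) → (∀ x → f x ≡ f []) × (f [] ≡ v)
  constant-via-state f F f≗F∘state F≡v =
    (λ x → trans (fx≡v x) (sym (fx≡v []))) , fx≡v []
    where fx≡v : ∀ x → f x ≡ _
          fx≡v x = trans (f≗F∘state x) (F≡v _)

  InM-σ : ∀ r s {v} → (∀ q → Paˢ r s q ≡ v) → (∀ q → Pbˢ r s q ≡ v) → InM r s σ × (P r s σ ≡ v)
  InM-σ r s Pa≡v Pb≡v = (λ x → proj₁ Pa-const x , trans (Pb≡P x) (sym (proj₂ Pa-const))) , proj₂ Pa-const
    where Pa-const = constant-via-state (Pa r s σ) (Paˢ r s) (Pa-σ r s) Pa≡v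
          Pb≡P : ∀ x → Pb r s σ x ≡ _
          Pb≡P x = trans (Pb-σ r s x) (Pb≡v _)

  P-witness : ∀ r s {v} → (∀ q → Paˢ r s q ≡ v) → (∀ q → Pbˢ r s q ≡ v) →
    ∃[ τ ] (IsAut τ × InM r s τ × (P r s τ ≡ v))
  P-witness r s Pa≡v Pb≡v = σ , isAut , InM-σ r s Pa≡v Pb≡v

  P̃₃₂-witness : ∀ {v w} → (∀ q → Paˢ 3 2 q ≡ v) → (∀ q → Pbˢ 3 2 q ≡ v) → (∀ q → R32ˢ q ≡ w) →
    ∃[ τ ] (IsAut τ × InMt 3 2 τ × (Pt 3 2 τ ≡ (v , w)))
  P̃₃₂-witness Pa≡v Pb≡v R≡w =
    σ , isAut , (proj₁ M , proj₁ R-const) , cong₂ _,_ (proj₂ M) (proj₂ R-const)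
    where M       = InM-σ 3 2 Pa≡v Pb≡v
          R-const = constant-via-state (R32 σ) R32ˢ R32-σ R≡w

  Rr1-witness : ∀ r {v} → (∀ q → Paˢ r 1 q ≡ false) → (∀ q → Pbˢ r 1 q ≡ false) →
    (∀ q → Rr1ˢ r q ≡ v) → ∃[ τ ] (IsAut τ × InMt r 1 τ × (Pt r 1 τ ≡ v))
  Rr1-witness r Pa≡0 Pb≡0 R≡v =
    σ , isAut , (InM-σ r 1 Pa≡0 Pb≡0 , proj₁ R-const) , proj₂ R-const
    where R-const = constant-via-state (Rr1 r σ) (Rr1ˢ r) (Rr1-σ r) R≡v

module Identity = Transducer {⊤} (λ _ _ → tt) tt (λ _ → false)

Σout-identity : ∀ k q → Identity.Σout k q ≡ false
Σout-identity zero    q = refl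
Σout-identity (suc k) q =
  trans (Identity.Σout-suc k q) (cong₂ _xor_ (Σout-identity k tt) (Σout-identity k tt))

Paˢ-identity : ∀ r s q → Identity.Paˢ r s q ≡ false
Paˢ-identity r s q = cong₂ _xor_ (Σout-identity (r ∸ 1) tt) (Σout-identity (s ∸ 1) tt)

Pbˢ-identity : ∀ r s q → Identity.Pbˢ r s q ≡ false
Pbˢ-identity r s q = cong₂ _xor_ (Σout-identity (r ∸ 1) tt) (Σout-identity (s ∸ 1) tt)

module TrailingB (m : ℕ) where

  next : ℕ → Letter → ℕ
  next n a = 0
  next n b = suc n

  open Transducer next 0 (λ n → does (m ≤? n)) public

  Σout-short : ∀ k n → k ≤ m → Σout k n ≡ does (m ≤? n + k)
  Σout-short zero    n _ = trans (xor-identityʳ _) (cong (λ i → does (m ≤? i)) (sym (+-identityʳ n)))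
  Σout-short (suc k) n k<m = trans (Σout-suc k n) (cong₂ _xor_
    (trans (Σout-short k 0 k≤m) (dec-false (m ≤? k) (<⇒≱ k<m)))
    (trans (Σout-short k (suc n) k≤m) (cong (λ i → does (m ≤? i)) (sym (+-suc n k)))))
    where k≤m = <⇒≤ k<m

  Σout-exact : ∀ n → Σout m n ≡ true
  Σout-exact n = trans (Σout-short m n ≤-refl) (dec-true (m ≤? n + m) (m≤n+m m n))

  Σout-long : ∀ {k} n → m < k → Σout k n ≡ false
  Σout-long {suc k} n m<1+k with m<1+n⇒m<n∨m≡n m<1+k
  ... | inj₁ m<k  = trans (Σout-suc k n) (cong₂ _xor_ (Σout-long 0 m<k) (Σout-long (suc n) m<k))
  ... | inj₂ refl = trans (Σout-suc k n) (cong₂ _xor_ (Σout-exact 0) (Σout-exact (suc n)))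

P-surjective : ∀ r s → 1 ≤ s → s < r → (v : Bool) → ∃[ σ ] (IsAut σ × InM r s σ × (P r s σ ≡ v))
P-surjective r s _ _ false = Identity.P-witness r s (Paˢ-identity r s) (Pbˢ-identity r s)
P-surjective (suc r) (suc s) (s≤s _) (s≤s s<r) true =
  TrailingB.P-witness s (suc r) (suc s)
    (λ q → cong₂ _xor_ (TrailingB.Σout-long s 0 s<r) (TrailingB.Σout-exact s (suc q)))
    (λ q → cong₂ _xor_ (TrailingB.Σout-long s (suc q) s<r) (TrailingB.Σout-exact s 0))

data Three : Set where
  s₀ s₁ s₂ : Three

firing : Three → Bool
firing s₀ = false
firing s₁ = true
firing s₂ = true

module R1Generator where

  next : Three → Letter → Three
  next s₀ a = s₀
  next s₀ b = s₁
  next s₁ _ = s₂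
  next s₂ a = s₀
  next s₂ b = s₁

  open Transducer next s₀ firing public

  Σout∞ : Three → Bool
  Σout∞ s₀ = true
  Σout∞ s₁ = false
  Σout∞ s₂ = true

  Σout-stable : ∀ k q → Σout (suc k) q ≡ Σout∞ q
  Σout-stable zero    s₀ = refl
  Σout-stable zero    s₁ = refl
  Σout-stable zero    s₂ = refl
  Σout-stable (suc k) q  = trans (Σout-suc (suc k) q)
    (trans (cong₂ _xor_ (Σout-stable k (next q a)) (Σout-stable k (next q b))) (Σout∞-step q))
    where Σout∞-step : ∀ q → Σout∞ (next q a) xor Σout∞ (next q b) ≡ Σout∞ q
          Σout∞-step s₀ = refl
          Σout∞-step s₁ = refl
          Σout∞-step s₂ = refl

  Paˢ≡0 : ∀ r q → Paˢ (3 + r) 1 q ≡ false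
  Paˢ≡0 r q rewrite Σout-stable (suc r) (next q a) = check q
    where check : ∀ q → Σout∞ (next q a) xor Σout 0 (next q b) ≡ false
          check s₀ = refl
          check s₁ = refl
          check s₂ = refl

  Pbˢ≡0 : ∀ r q → Pbˢ (3 + r) 1 q ≡ false
  Pbˢ≡0 r q rewrite Σout-stable (suc r) (next q b) = check q
    where check : ∀ q → Σout∞ (next q b) xor Σout 0 (next q a) ≡ false
          check s₀ = refl
          check s₁ = refl
          check s₂ = refl

  Rr1ˢ≡1 : ∀ r q → Rr1ˢ (3 + r) q ≡ true
  Rr1ˢ≡1 r q rewrite Σout-stable r (run q (a ∷ b ∷ [])) | Σout-stable r (run q (b ∷ b ∷ [])) = check q
    where check : ∀ q → (firing (run q [ a ]) ∧ firing (run q [ b ]))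
                        xor (Σout∞ (run q (a ∷ b ∷ [])) xor Σout∞ (run q (b ∷ b ∷ []))) ≡ true
          check s₀ = refl
          check s₁ = refl
          check s₂ = refl

Rr1-surjective : ∀ r → 3 ≤ r → (v : Bool) → ∃[ σ ] (IsAut σ × InMt r 1 σ × (Pt r 1 σ ≡ v))
Rr1-surjective r _ false = Identity.Rr1-witness r (Paˢ-identity r 1) (Pbˢ-identity r 1)
  (λ q → cong (false xor_) (cong₂ _xor_ (Σout-identity (r ∸ 2) tt) (Σout-identity (r ∸ 2) tt)))
Rr1-surjective (suc (suc (suc r))) (s≤s (s≤s (s≤s _))) true =
  R1Generator.Rr1-witness (3 + r) (R1Generator.Paˢ≡0 r) (R1Generator.Pbˢ≡0 r) (R1Generator.Rr1ˢ≡1 r)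

module P32Generator where

  next : Three → Letter → Three
  next s₀ a = s₀
  next s₀ b = s₁
  next s₁ a = s₀
  next s₁ b = s₂
  next s₂ a = s₂
  next s₂ b = s₀

  open Transducer next s₀ firing public

isB : Letter → Bool
isB a = false
isB b = true

module LastLetterB = Transducer {Bool} (λ _ → isB) false (λ l → l)

module Sum32Generator = Transducer {Three × Bool} (λ (q , _) c → P32Generator.next q c , isB c) (s₀ , false)
  (λ (q , l) → firing q xor l)

P̃₃₂-surjective : (h : Bool × Bool) → ∃[ σ ] (IsAut σ × InMt 3 2 σ × (Pt 3 2 σ ≡ h))
P̃₃₂-surjective (false , false) =
  Identity.P̃₃₂-witness (λ _ → refl) (λ _ → refl) (λ _ → refl)
P̃₃₂-surjective (true , false) = P32Generator.P̃₃₂-witness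
  (λ { s₀ → refl ; s₁ → refl ; s₂ → refl })
  (λ { s₀ → refl ; s₁ → refl ; s₂ → refl })
  (λ { s₀ → refl ; s₁ → refl ; s₂ → refl })
P̃₃₂-surjective (true , true) = LastLetterB.P̃₃₂-witness
  (λ { false → refl ; true → refl })
  (λ { false → refl ; true → refl })
  (λ { false → refl ; true → refl })
P̃₃₂-surjective (false , true) = Sum32Generator.P̃₃₂-witness
  (λ { (s₀ , false) → refl ; (s₀ , true) → refl ; (s₁ , false) → refl
     ; (s₁ , true) → refl ; (s₂ , false) → refl ; (s₂ , true) → refl })
  (λ { (s₀ , false) → refl ; (s₀ , true) → refl ; (s₁ , false) → refl
     ; (s₁ , true) → refl ; (s₂ , false) → refl ; (s₂ , true) → refl })
  (λ { (s₀ , false) → refl ; (s₀ , true) → refl ; (s₁ , false) → refl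
     ; (s₁ , true) → refl ; (s₂ , false) → refl ; (s₂ , true) → refl })

lemma7p2 : (r s : ℕ) → 1 ≤ s → s < r → 3 ≤ r →
    (h : H r s) → ∃[ σ ] (IsAut σ × InMt r s σ × (Pt r s σ ≡ h))
lemma7p2 r zero () _ _ _
lemma7p2 r (suc zero) _ _ 3≤r h = Rr1-surjective r 3≤r h
lemma7p2 zero (suc (suc s)) _ () _ _
lemma7p2 (suc zero) (suc (suc s)) _ (s≤s ()) _ _
lemma7p2 (suc (suc zero)) (suc (suc s)) _ (s≤s (s≤s ())) _ _
lemma7p2 (suc (suc (suc zero))) (suc (suc zero)) _ _ _ h = P̃₃₂-surjective h
lemma7p2 (suc (suc (suc zero))) (suc (suc (suc s))) _ (s≤s (s≤s (s≤s ()))) _ _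
lemma7p2 (suc (suc (suc (suc r)))) (suc (suc s)) 1≤s s<r _ h = P-surjective _ _ 1≤s s<r h
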